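{- Let $\beta:Y\rightharpoonup\wp(Z)$ and $\gamma:Z\rightharpoonup\wp(W)$ be relations. Then (a) $\beta_\diamond\gamma_\diamond\sqsubseteq(\beta\gamma_\diamond)_\diamond$; (b) $\gamma_\diamond=\Xi_Z\,((\gamma^\sharp)^@)^\sharp$; (c) $(\beta\gamma_\diamond)_\diamond\sqsubseteq(\beta\Xi_Z)_\diamond\gamma_\diamond$; (d) $1_Y\Xi_Y=\ni_Y^\sharp$ and $1_Y\sqsubseteq\ni_Y^\sharp$; (e) $\ni_Y^\sharp\beta_\diamond=\beta$; (f) $(\ni_Z^\sharp)_\diamond=\Xi_Z$.
   Context: Relations $\alpha:X\rightharpoonup Y$ are subsets of $X\times Y$; juxtaposition is relational composition; $\sqsubseteq$ is inclusion; $\alpha^\sharp$ is the converse. $\ni_Y:\wp(Y)\rightharpoonup Y$ is membership ($(A,y)\in\ni_Y$ iff $y\in A$). $\Xi_Y:\wp(Y)\rightharpoonup\wp(Y)$ is inclusion of sets ($(A,B)\in\Xi_Y$ iff $A\subseteq B$). For $\rho:X\rightharpoonup Y$, $\rho^@:X\to\wp(Y)$ is the function $x\mapsto\{y\mid(x,y)\in\rho\}$. $1_Y:Y\to\wp(Y)$ is $y\mapsto\{y\}$. For $\beta:Y\rightharpoonup\wp(Z)$ the Parikh lifting $\beta_\diamond:\wp(Y)\rightharpoonup\wp(Z)$ is given by $(B,A)\in\beta_\diamond$ iff $\forall b\in B.\,(b,A)\in\beta$. -}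

module Defs where

open import Level using (Level; _⊔_; Lift)
open import Data.Product using (Σ; _×_; _,_)
open import Relation.Binary.PropositionalEquality using (_≡_)

private variable
  a b c ℓ ℓ′ : Level

℘ : Set → Set₁
℘ Y = Y → Set

Rel : Set a → Set b → (ℓ : Level) → Set (a ⊔ b ⊔ Level.suc ℓ)
Rel X Y ℓ = X → Y → Set ℓ

infixr 9 _⨾_
-- relational composition (juxtaposition αβ): (x,z) ∈ αβ iff ∃ y. (x,y) ∈ α and (y,z) ∈ β
_⨾_ : {X : Set a} {Y : Set b} {Z : Set c} →
      Rel X Y ℓ → Rel Y Z ℓ′ → Rel X Z (b ⊔ ℓ ⊔ ℓ′)
(α ⨾ β) x z = Σ _ λ y → α x y × β y z

_♯ : {X : Set a} {Y : Set b} → Rel X Y ℓ → Rel Y X ℓ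
(α ♯) y x = α x y

infix 4 _⊑_ _≐_
_⊑_ : {X : Set a} {Y : Set b} → Rel X Y ℓ → Rel X Y ℓ′ → Set (a ⊔ b ⊔ ℓ ⊔ ℓ′)
α ⊑ β = ∀ x y → α x y → β x y

_≐_ : {X : Set a} {Y : Set b} → Rel X Y ℓ → Rel X Y ℓ′ → Set (a ⊔ b ⊔ ℓ ⊔ ℓ′)
α ≐ β = (α ⊑ β) × (β ⊑ α)

graph : {X : Set a} {Y : Set b} → (X → Y) → Rel X Y b
graph f x y = f x ≡ y

∋ : (Y : Set) → Rel (℘ Y) Y Level.zero
∋ Y A y = A y

Ξ : (Y : Set) → Rel (℘ Y) (℘ Y) Level.zero
Ξ Y A B = ∀ y → A y → B y

-- ρ^@ (written ρ ᵃ) : X → ℘(Y),  x ↦ {y | (x,y) ∈ ρ}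
_ᵃ : {X : Set a} {Y : Set} → Rel X Y Level.zero → X → ℘ Y
(ρ ᵃ) x y = ρ x y

𝟙 : (Y : Set) → Y → ℘ Y
𝟙 Y y y′ = y ≡ y′

_⋄ : {Y : Set} {P : Set a} → Rel Y P ℓ → Rel (℘ Y) P ℓ
(β ⋄) B A = ∀ b → B b → β b A

module Submission where

open import Defs
open import Level using (Level; 0ℓ)
open import Data.Product using (_×_; _,_)
open import Relation.Binary.PropositionalEquality using (refl)

private variable
  a b ℓ ℓ′ : Level

⋄⨾-⊑-⨾⋄ : {Y : Set} {P : Set a} {Q : Set b} (β : Rel Y P ℓ) (δ : Rel P Q ℓ′) →
          (β ⋄) ⨾ δ ⊑ (β ⨾ δ) ⋄
⋄⨾-⊑-⨾⋄ β δ B A (C , β⋄BC , δCA) y y∈B = C , β⋄BC y y∈B , δCA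

-- Both sides say that B is included in the preimage {z | (z, A) ∈ γ}.
⋄-≐-Ξ⨾ᵃ♯ : {Z : Set} {P : Set a} (γ : Rel Z P 0ℓ) →
           γ ⋄ ≐ Ξ Z ⨾ graph ((γ ♯) ᵃ) ♯
⋄-≐-Ξ⨾ᵃ♯ γ = (λ B A B⊆γ⁻A → ((γ ♯) ᵃ) A , B⊆γ⁻A , refl)
           , λ { B A (C , B⊆C , refl) → B⊆C }

-- The intermediate set is again the preimage of A under γ.
⨾⋄⋄-⊑-⨾Ξ⋄⨾⋄ : {Y Z : Set} {P : Set a} (β : Rel Y (℘ Z) ℓ) (γ : Rel Z P 0ℓ) →
              (β ⨾ γ ⋄) ⋄ ⊑ (β ⨾ Ξ Z) ⋄ ⨾ γ ⋄
⨾⋄⋄-⊑-⨾Ξ⋄⨾⋄ {Z = Z} β γ B A h = (λ z → γ z A) , through-preimage , λ z γzA → γzA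
  where
  through-preimage : ((β ⨾ Ξ Z) ⋄) B (λ z → γ z A)
  through-preimage y y∈B with h y y∈B
  ... | C , βyC , γ⋄CA = C , βyC , γ⋄CA

𝟙⨾Ξ-≐-∋♯ : (Y : Set) → graph (𝟙 Y) ⨾ Ξ Y ≐ ∋ Y ♯
𝟙⨾Ξ-≐-∋♯ Y = (λ { y A (_ , refl , y⊆A) → y⊆A y refl })
           , λ y A y∈A → 𝟙 Y y , refl , λ { _ refl → y∈A }

𝟙-⊑-∋♯ : (Y : Set) → graph (𝟙 Y) ⊑ ∋ Y ♯
𝟙-⊑-∋♯ Y y _ refl = refl

∋♯⨾⋄-≐ : {Y : Set} {P : Set a} (β : Rel Y P ℓ) → ∋ Y ♯ ⨾ β ⋄ ≐ β
∋♯⨾⋄-≐ {Y = Y} β = (λ { y A (B , y∈B , β⋄BA) → β⋄BA y y∈B })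
                 , λ y A βyA → 𝟙 Y y , refl , λ { _ refl → βyA }

∋♯⋄-≐-Ξ : (Z : Set) → ∋ Z ♯ ⋄ ≐ Ξ Z
∋♯⋄-≐-Ξ Z = (λ B A B⊆A → B⊆A) , (λ B A B⊆A → B⊆A)

proposition5p1 : {Y Z W : Set} (β : Rel Y (℘ Z) 0ℓ) (γ : Rel Z (℘ W) 0ℓ) →
    ((β ⋄) ⨾ (γ ⋄) ⊑ ((β ⨾ (γ ⋄)) ⋄))
    × ((γ ⋄) ≐ (Ξ Z ⨾ ((graph ((γ ♯) ᵃ)) ♯)))
    × (((β ⨾ (γ ⋄)) ⋄) ⊑ ((β ⨾ Ξ Z) ⋄) ⨾ (γ ⋄))
    × (((graph (𝟙 Y) ⨾ Ξ Y) ≐ (∋ Y ♯)) × (graph (𝟙 Y) ⊑ (∋ Y ♯)))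
    × (((∋ Y ♯) ⨾ (β ⋄)) ≐ β)
    × (((∋ Z ♯) ⋄) ≐ Ξ Z)
proposition5p1 {Y} {Z} β γ =
    ⋄⨾-⊑-⨾⋄ β (γ ⋄)
  , ⋄-≐-Ξ⨾ᵃ♯ γ
  , ⨾⋄⋄-⊑-⨾Ξ⋄⨾⋄ β γ
  , (𝟙⨾Ξ-≐-∋♯ Y , 𝟙-⊑-∋♯ Y)
  , ∋♯⨾⋄-≐ β
  , ∋♯⋄-≐-Ξ Z
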